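{- If $G=K_m+\overline{K}_n$ and $n\ge 2$, then $\mathrm{nim}(\mathrm{DNG}(G))=1-\mathrm{pty}(m+n)$ and $\mathrm{nim}(\mathrm{GEN}(G))=\mathrm{pty}(m+n)$.
   Context: $K_m+\overline{K}_n$ is the complete split graph, the join of the complete graph $K_m$ and the edgeless graph $\overline{K}_n$. For a graph $G=(V,E)$, a set of vertices is geodetically convex if it contains every vertex on every shortest path between two of its vertices; the convex hull $[P]$ is the smallest convex set containing $P$, and $P$ is generating if $[P]=V$. In the achievement game $\mathrm{GEN}(G)$, two players alternately select previously-unselected vertices; the game ends as soon as the selected set generates, and the last player to move wins. In the avoidance game $\mathrm{DNG}(G)$, players alternately select previously-unselected vertices such that the selected set never generates; the player who cannot move loses. $\mathrm{nim}$ denotes the nim-number of an impartial game, and $\mathrm{pty}(k):=k\bmod 2$. -}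

module Defs where

open import Data.Nat using (ℕ; zero; suc; _+_; _≤_; _<_)
open import Data.Nat.Properties using (_≟_)
open import Data.Fin using (Fin; toℕ)
open import Data.Fin.Subset using (Subset; _∈_; _⊆_; _∪_; ⁅_⁆; ⊥)
open import Data.Fin.Subset.Properties using (_∈?_)
open import Data.List using (List; []; _∷_; length; map; filter)
open import Data.List.Membership.DecPropositional _≟_ using () renaming (_∈?_ to _∈ℕ?_)
open import Data.Vec using (tabulate)
open import Data.Product using (_×_)
open import Data.Sum using (_⊎_)
open import Data.Bool using (if_then_else_)
open import Relation.Nullary using (Dec; yes; no; ¬_; does)
open import Relation.Binary.PropositionalEquality using (_≢_)
open import Data.List using (allFin)

Graph : ℕ → Set₁
Graph N = Fin N → Fin N → Set

-- The complete split graph K_m + \overline{K}_n on Fin (m + n):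
-- vertices with index < m form the clique K_m, the others the
-- independent set; two distinct vertices are adjacent iff at least
-- one of them lies in the clique.
completeSplit : (m n : ℕ) → Graph (m + n)
completeSplit m n i j = (i ≢ j) × (toℕ i < m ⊎ toℕ j < m)

module _ {N : ℕ} (G : Graph N) where

  data Walk : Fin N → Fin N → Set where
    []  : ∀ {x} → Walk x x
    _∷_ : ∀ {x y z} → G x y → Walk y z → Walk x z

  walkLength : ∀ {x y} → Walk x y → ℕ
  walkLength []      = 0
  walkLength (_ ∷ w) = suc (walkLength w)

  data OnWalk (z : Fin N) : ∀ {x y} → Walk x y → Set where
    here  : ∀ {y} {w : Walk z y} → OnWalk z w
    there : ∀ {x y v} {e : G x v} {w : Walk v y} → OnWalk z w → OnWalk z (e ∷ w)

  IsShortest : ∀ {x y} → Walk x y → Set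
  IsShortest {x} {y} w = (w' : Walk x y) → walkLength w ≤ walkLength w'

  Convex : Subset N → Set
  Convex S = ∀ x y → x ∈ S → y ∈ S → (w : Walk x y) → IsShortest w →
             ∀ z → OnWalk z w → z ∈ S

  IsHull : Subset N → Subset N → Set
  IsHull H P = Convex H × P ⊆ H × (∀ S → Convex S → P ⊆ S → H ⊆ S)

  Generates : Subset N → Set
  Generates P = ∀ H → IsHull H P → ∀ v → v ∈ H

mexFrom : ℕ → ℕ → List ℕ → ℕ
mexFrom zero    k xs = k
mexFrom (suc f) k xs = if does (k ∈ℕ? xs) then mexFrom f (suc k) xs else k

mex : List ℕ → ℕ
mex xs = mexFrom (suc (length xs)) 0 xs

-- A position is the set of selected
-- vertices; a move selects one previously unselected vertex.  The
-- fuel argument equals the number of unselected vertices, so the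
-- recursion is exact (a position with no unselected vertex has no
-- moves).  The games are defined relative to a decision procedure for
-- Generates; the resulting value does not depend on the choice.

module _ {N : ℕ} (G : Graph N) (dec : (P : Subset N) → Dec (Generates G P)) where

  unselected : Subset N → List (Fin N)
  unselected P = filter (λ i → Relation.Nullary.¬? (i ∈? P)) (allFin N)

  nimDNGAt : ℕ → Subset N → ℕ
  nimDNGAt zero    P = 0
  nimDNGAt (suc f) P =
    mex (map (λ i → nimDNGAt f (P ∪ ⁅ i ⁆))
             (filter (λ i → Relation.Nullary.¬? (dec (P ∪ ⁅ i ⁆))) (unselected P)))

  nimGENAt : ℕ → Subset N → ℕ
  nimGENAt zero    P = 0
  nimGENAt (suc f) P with dec P
  ... | yes _ = 0
  ... | no  _ = mex (map (λ i → nimGENAt f (P ∪ ⁅ i ⁆)) (unselected P))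

  nimDNG : ℕ
  nimDNG = nimDNGAt N ⊥

  nimGEN : ℕ
  nimGEN = nimGENAt N ⊥

-- A set P of vertices of K_m + K̄_n (n ≥ 2) generates iff it contains the whole
-- independent set I: an inner vertex of a shortest path is a clique vertex between
-- two distinct independent vertices, and every clique vertex lies on a geodesic
-- between any two distinct independent vertices.  So a position is described by the numbers of
-- unselected vertices in I and outside I.  In DNG every play ends exactly when one
-- vertex of I is left, so all options of a position have the same value and the
-- nim-number is a parity.  In GEN a position with a single unselected vertex of I
-- has value 1 + (parity of the unselected clique vertices), and otherwise the value
-- is the parity of the number of unselected vertices.
module Submission where

open import Defs
open import Data.Nat using (ℕ; zero; suc; _+_; _∸_; _≤_; _<_; _%_; z≤n; s≤s; z<s; s<s)
open import Data.Nat.Properties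
  using (<⇒≱; ≤-pred; n>0⇒n≢0; 0≢1+n; 1+n≢n; suc-injective; m+n≡0⇒m≡0; m+[n∸m]≡n; ≤-antisym; ≤-trans; ≤-refl; <⇒≤; ≤∧≢⇒<; ≮⇒≥; m≤m+n; m≤n⇒m≤1+n; +-suc)
  renaming (_≟_ to _≟ℕ_)
open import Data.Fin using (Fin; toℕ) renaming (zero to fzero; suc to fsuc)
open import Data.Fin.Properties using (any?; _≟_; pigeonhole; toℕ<n; toℕ-injective; <⇒≢)
  renaming (suc-injective to fsuc-injective)
open import Data.Fin.Subset using (Subset; inside; outside; _∈_; _∉_; _⊆_; _─_; _-_; _∪_; ∁; ⁅_⁆; ⊤; ⊥; ∣_∣; Nonempty)
open import Data.Fin.Subset.Properties using (_∈?_; ∈⊤; ∣⊤∣≡n; p⊆p∪q; q⊆p∪q; x∈p∪q⁻; x∈p⇒x∉∁p; x∉p⇒x∈∁p; x∈∁p⇒x∉p; ∣∁p∣≡n∸∣p∣; ∣p∣≤n; p─⊥≡p; p─q─r≡p─q∪r; p─q⊆p; x∈p∧x∉q⇒x∈p─q; ∣p∣≤∣x∷p∣; drop-there)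
open import Data.List using (List; length; lookup; map; filter; allFin)
open import Data.List.Relation.Unary.Any using (index)
open import Data.List.Relation.Unary.Any.Properties using (lookup-index)
open import Data.List.Membership.Propositional using () renaming (_∈_ to _∈ˡ_; _∉_ to _∉ˡ_)
open import Data.List.Membership.Propositional.Properties using (∈-filter⁺; ∈-filter⁻; ∈-map⁺; ∈-map⁻; ∈-allFin)
open import Data.List.Membership.DecPropositional _≟ℕ_ using () renaming (_∈?_ to _∈ˡ?_)
open import Data.Vec using (_∷_; here; there)
open import Data.Product using (_×_; _,_; ∃; ∃₂)
open import Data.Sum using (_⊎_; inj₁; inj₂; [_,_])
import Data.Product as Product
open import Function using (_∘_)
open import Relation.Nullary using (Dec; yes; no; ¬_; ¬?; contradiction)
open import Relation.Nullary.Decidable using (decidable-stable; _×-dec_)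
open import Function.Bundles using (_⇔_; mk⇔; Equivalence)
import Function.Properties.Equivalence as ⇔
open import Relation.Binary.PropositionalEquality using (_≡_; _≢_; refl; sym; trans; cong; cong₂; subst; module ≡-Reasoning)

[1+n]%2≢n%2 : ∀ n → suc n % 2 ≢ n % 2
[1+n]%2≢n%2 zero          ()
[1+n]%2≢n%2 (suc zero)    ()
[1+n]%2≢n%2 (suc (suc n)) = [1+n]%2≢n%2 n

m<n%2⇒m≡[1+n]%2 : ∀ {m} n → m < n % 2 → m ≡ suc n % 2
m<n%2⇒m≡[1+n]%2 (suc zero)    (s≤s z≤n) = refl
m<n%2⇒m≡[1+n]%2 (suc (suc n)) m<n%2     = m<n%2⇒m≡[1+n]%2 n m<n%2

m<n%2⇒0<n : ∀ {m} n → m < n % 2 → 0 < n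
m<n%2⇒0<n (suc n) _ = s≤s z≤n

[1+n]%2≡1∸n%2 : ∀ n → suc n % 2 ≡ 1 ∸ n % 2
[1+n]%2≡1∸n%2 zero          = refl
[1+n]%2≡1∸n%2 (suc zero)    = refl
[1+n]%2≡1∸n%2 (suc (suc n)) = [1+n]%2≡1∸n%2 n

mexFrom≡ : ∀ {xs v} f k → k ≤ v → v ≤ f + k → v ∉ˡ xs →
           (∀ {u} → k ≤ u → u < v → u ∈ˡ xs) → mexFrom f k xs ≡ v
mexFrom≡ zero k k≤v v≤k _ _ = ≤-antisym k≤v v≤k
mexFrom≡ {xs} {v} (suc f) k k≤v v≤f+k v∉xs below with k ∈ˡ? xs
... | yes k∈xs = mexFrom≡ f (suc k) k<v (subst (v ≤_) (sym (+-suc f k)) v≤f+k) v∉xs (below ∘ <⇒≤)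
  where
  k<v : k < v
  k<v = ≤∧≢⇒< k≤v λ { refl → v∉xs k∈xs }
... | no k∉xs = ≤-antisym k≤v (≮⇒≥ (k∉xs ∘ below ≤-refl))

-- Pigeonhole: the positions of 0, …, v - 1 in xs are pairwise distinct.
length≥ : ∀ {xs v} → (∀ {u} → u < v → u ∈ˡ xs) → v ≤ length xs
length≥ {xs} below = ≮⇒≥ λ length<v →
  let (i , j , i<j , same) = pigeonhole length<v (index ∘ below ∘ toℕ<n)
  in <⇒≢ i<j (toℕ-injective (trans (lookup-index (below (toℕ<n i)))
       (trans (cong (lookup xs) same) (sym (lookup-index (below (toℕ<n j)))))))

mex≡ : ∀ {xs v} → v ∉ˡ xs → (∀ {u} → u < v → u ∈ˡ xs) → mex xs ≡ v
mex≡ {xs} v∉xs below =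
  mexFrom≡ (suc (length xs)) 0 z≤n (≤-trans (m≤n⇒m≤1+n (length≥ below)) (m≤m+n _ 0)) v∉xs (λ _ → below)

x∈p─q⁻ : ∀ {n} {x : Fin n} (p q : Subset n) → x ∈ p ─ q → x ∈ p × x ∉ q
x∈p─q⁻ {x = fzero}  (inside  ∷ p) (outside ∷ q) here          = here , λ ()
x∈p─q⁻ {x = fzero}  (outside ∷ p) (outside ∷ q) ()
x∈p─q⁻ {x = fzero}  (_       ∷ p) (inside  ∷ q) ()
x∈p─q⁻ {x = fsuc x} (_       ∷ p) (_       ∷ q) (there x∈p─q) =
  Product.map there (λ x∉q → x∉q ∘ drop-there) (x∈p─q⁻ p q x∈p─q)

x∈p⇒∣p∣>0 : ∀ {n} {x : Fin n} {p : Subset n} → x ∈ p → 0 < ∣ p ∣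
x∈p⇒∣p∣>0 here                    = s≤s z≤n
x∈p⇒∣p∣>0 {p = s ∷ p} (there x∈p) = ≤-trans (x∈p⇒∣p∣>0 x∈p) (∣p∣≤∣x∷p∣ s p)

∣p∣>0⇒Nonempty : ∀ {n} (p : Subset n) → 0 < ∣ p ∣ → Nonempty p
∣p∣>0⇒Nonempty (inside  ∷ p) _     = fzero , here
∣p∣>0⇒Nonempty (outside ∷ p) ∣p∣>0 = Product.map fsuc there (∣p∣>0⇒Nonempty p ∣p∣>0)

∣p∣>1⇒∃≢ : ∀ {n} (p : Subset n) → 1 < ∣ p ∣ → ∃₂ λ x y → x ∈ p × y ∈ p × x ≢ y
∣p∣>1⇒∃≢ (inside ∷ p) (s≤s ∣p∣>0) =
  let (y , y∈p) = ∣p∣>0⇒Nonempty p ∣p∣>0 in fzero , fsuc y , here , there y∈p , λ ()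
∣p∣>1⇒∃≢ (outside ∷ p) ∣p∣>1 =
  let (x , y , x∈p , y∈p , x≢y) = ∣p∣>1⇒∃≢ p ∣p∣>1
  in fsuc x , fsuc y , there x∈p , there y∈p , x≢y ∘ fsuc-injective

x∈p⇒∣p∣≡1+∣p-x∣ : ∀ {n} {x : Fin n} {p : Subset n} → x ∈ p → ∣ p ∣ ≡ suc ∣ p - x ∣
x∈p⇒∣p∣≡1+∣p-x∣ {p = inside ∷ p}  here        = cong (suc ∘ ∣_∣) (sym (p─⊥≡p p))
x∈p⇒∣p∣≡1+∣p-x∣ {p = inside ∷ p}  (there x∈p) = cong suc (x∈p⇒∣p∣≡1+∣p-x∣ x∈p)
x∈p⇒∣p∣≡1+∣p-x∣ {p = outside ∷ p} (there x∈p) = x∈p⇒∣p∣≡1+∣p-x∣ x∈p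

x∉p⇒p-x≡p : ∀ {n} {x : Fin n} {p : Subset n} → x ∉ p → p - x ≡ p
x∉p⇒p-x≡p {x = fzero}  {inside  ∷ p} x∉p = contradiction here x∉p
x∉p⇒p-x≡p {x = fzero}  {outside ∷ p} x∉p = cong (outside ∷_) (p─⊥≡p p)
x∉p⇒p-x≡p {x = fsuc x} {s ∷ p}       x∉p = cong (s ∷_) (x∉p⇒p-x≡p (x∉p ∘ there))

∣p─q∣≡1+∣p─[q∪⁅x⁆]∣ : ∀ {n} {x : Fin n} (p q : Subset n) → x ∈ p → x ∉ q →
                      ∣ p ─ q ∣ ≡ suc ∣ p ─ (q ∪ ⁅ x ⁆) ∣
∣p─q∣≡1+∣p─[q∪⁅x⁆]∣ {x = x} p q x∈p x∉q =
  trans (x∈p⇒∣p∣≡1+∣p-x∣ (x∈p∧x∉q⇒x∈p─q x∈p x∉q)) (cong (suc ∘ ∣_∣) (p─q─r≡p─q∪r p q ⁅ x ⁆))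

x∉p⇒p─[q∪⁅x⁆]≡p─q : ∀ {n} {x : Fin n} (p q : Subset n) → x ∉ p → p ─ (q ∪ ⁅ x ⁆) ≡ p ─ q
x∉p⇒p─[q∪⁅x⁆]≡p─q {x = x} p q x∉p =
  trans (sym (p─q─r≡p─q∪r p q ⁅ x ⁆)) (x∉p⇒p-x≡p (x∉p ∘ p─q⊆p p q))

∣p─q∣>0⇒∃ : ∀ {n} (p q : Subset n) → 0 < ∣ p ─ q ∣ → ∃ λ x → x ∈ p × x ∉ q
∣p─q∣>0⇒∃ p q ∣p─q∣>0 = Product.map₂ (x∈p─q⁻ p q) (∣p∣>0⇒Nonempty (p ─ q) ∣p─q∣>0)

p⊆q⇔∣p─q∣≡0 : ∀ {n} (p q : Subset n) → p ⊆ q ⇔ ∣ p ─ q ∣ ≡ 0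
p⊆q⇔∣p─q∣≡0 p q = mk⇔ to from
  where
  to : p ⊆ q → ∣ p ─ q ∣ ≡ 0
  to p⊆q with ∣ p ─ q ∣ in eq
  ... | zero  = refl
  ... | suc _ = let (x , x∈p , x∉q) = ∣p─q∣>0⇒∃ p q (subst (0 <_) (sym eq) z<s)
                in contradiction (p⊆q x∈p) x∉q
  from : ∣ p ─ q ∣ ≡ 0 → p ⊆ q
  from ∣p─q∣≡0 {x} x∈p = decidable-stable (x ∈? q) λ x∉q →
    n>0⇒n≢0 (x∈p⇒∣p∣>0 (x∈p∧x∉q⇒x∈p─q x∈p x∉q)) ∣p─q∣≡0

mex≡n%2 : ∀ f {xs} → (∀ {y} → y ∈ˡ xs → y ≡ suc f % 2) → (0 < f → suc f % 2 ∈ˡ xs) → mex xs ≡ f % 2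
mex≡n%2 f {xs} options≡ nonempty = mex≡ (λ f%2∈xs → [1+n]%2≢n%2 f (sym (options≡ f%2∈xs))) below
  where
  below : ∀ {u} → u < f % 2 → u ∈ˡ xs
  below u<f%2 = subst (_∈ˡ xs) (sym (m<n%2⇒m≡[1+n]%2 f u<f%2)) (nonempty (m<n%2⇒0<n f u<f%2))

-- The GEN value of a position with a unselected vertices of I among f unselected vertices.
genValue : ℕ → ℕ → ℕ
genValue zero          f = 0
genValue (suc zero)    f = suc (suc f % 2)
genValue (suc (suc _)) f = f % 2

mex-genValue : ∀ a c {f xs} → f ≡ a + c →
               (∀ {y} → y ∈ˡ xs → y ≡ genValue a f ⊎ y ≡ genValue (suc a) f) →
               genValue a f ∈ˡ xs → (0 < c → genValue (suc a) f ∈ˡ xs) →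
               mex xs ≡ genValue (suc a) (suc f)
mex-genValue zero c {xs = xs} refl options≡ 0∈xs nonempty = mex≡ notOption below
  where
  notOption : suc (c % 2) ∉ˡ xs
  notOption v∈xs with options≡ v∈xs
  ... | inj₁ ()
  ... | inj₂ v≡ = [1+n]%2≢n%2 c (sym (suc-injective v≡))
  below : ∀ {u} → u < suc (c % 2) → u ∈ˡ xs
  below {zero}  _           = 0∈xs
  below {suc u} (s≤s u<c%2) =
    subst (_∈ˡ xs) (cong suc (sym (m<n%2⇒m≡[1+n]%2 c u<c%2))) (nonempty (m<n%2⇒0<n c u<c%2))
mex-genValue (suc zero) c {xs = xs} refl options≡ _ nonempty = mex≡ notOption below
  where
  notOption : c % 2 ∉ˡ xs
  notOption v∈xs with options≡ v∈xs
  ... | inj₁ v≡ = 1+n≢n (sym v≡)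
  ... | inj₂ v≡ = [1+n]%2≢n%2 c (sym v≡)
  below : ∀ {u} → u < c % 2 → u ∈ˡ xs
  below u<c%2 = subst (_∈ˡ xs) (sym (m<n%2⇒m≡[1+n]%2 c u<c%2)) (nonempty (m<n%2⇒0<n c u<c%2))
mex-genValue (suc (suc a)) c {xs = xs} refl options≡ [a+c]%2∈xs _ = mex≡ notOption below
  where
  notOption : suc (a + c) % 2 ∉ˡ xs
  notOption v∈xs with options≡ v∈xs
  ... | inj₁ v≡ = [1+n]%2≢n%2 (a + c) v≡
  ... | inj₂ v≡ = [1+n]%2≢n%2 (a + c) v≡
  below : ∀ {u} → u < suc (a + c) % 2 → u ∈ˡ xs
  below u<v = subst (_∈ˡ xs) (sym (m<n%2⇒m≡[1+n]%2 (suc (a + c)) u<v)) [a+c]%2∈xs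

genValue-≥2 : ∀ {a} f → 1 < a → genValue a f ≡ f % 2
genValue-≥2 f (s≤s (s≤s z≤n)) = refl

module SupersetGeneration {N : ℕ} (G : Graph N) (I : Subset N)
  (generates⇔ : ∀ {P} → Generates G P ⇔ I ⊆ P)
  (dec : (P : Subset N) → Dec (Generates G P)) where

  open Equivalence

  generates⇔∣I─P∣≡0 : ∀ {P} → Generates G P ⇔ ∣ I ─ P ∣ ≡ 0
  generates⇔∣I─P∣≡0 {P} = ⇔.trans generates⇔ (p⊆q⇔∣p─q∣≡0 I P)

  ∣I─P∣≡1+n⇒¬generates : ∀ {P a} → ∣ I ─ P ∣ ≡ suc a → ¬ Generates G P
  ∣I─P∣≡1+n⇒¬generates eq gen = 0≢1+n (trans (sym (to generates⇔∣I─P∣≡0 gen)) eq)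

  #unselected : Subset N → ℕ
  #unselected P = ∣ I ─ P ∣ + ∣ ∁ I ─ P ∣

  #unselected-select : ∀ {P i} → i ∉ P → #unselected P ≡ suc (#unselected (P ∪ ⁅ i ⁆))
  #unselected-select {P} {i} i∉P with i ∈? I
  ... | yes i∈I = cong₂ _+_ (∣p─q∣≡1+∣p─[q∪⁅x⁆]∣ I P i∈I i∉P)
                            (sym (cong ∣_∣ (x∉p⇒p─[q∪⁅x⁆]≡p─q (∁ I) P (x∈p⇒x∉∁p i∈I))))
  ... | no  i∉I = trans (cong₂ _+_ (sym (cong ∣_∣ (x∉p⇒p─[q∪⁅x⁆]≡p─q I P i∉I)))
                                   (∣p─q∣≡1+∣p─[q∪⁅x⁆]∣ (∁ I) P (x∉p⇒x∈∁p i∉I) i∉P))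
                        (+-suc _ _)

  #unselected-⊥ : #unselected ⊥ ≡ N
  #unselected-⊥ = begin
    ∣ I ─ ⊥ ∣ + ∣ ∁ I ─ ⊥ ∣   ≡⟨ cong₂ _+_ (cong ∣_∣ (p─⊥≡p I)) (cong ∣_∣ (p─⊥≡p (∁ I))) ⟩
    ∣ I ∣ + ∣ ∁ I ∣           ≡⟨ cong (∣ I ∣ +_) (∣∁p∣≡n∸∣p∣ I) ⟩
    ∣ I ∣ + (N ∸ ∣ I ∣)       ≡⟨ m+[n∸m]≡n (∣p∣≤n I) ⟩
    N                         ∎
    where open ≡-Reasoning

  ∈unselected⁺ : ∀ {P i} → i ∉ P → i ∈ˡ unselected G dec P
  ∈unselected⁺ {P} i∉P = ∈-filter⁺ (λ j → ¬? (j ∈? P)) (∈-allFin _) i∉P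

  ∈unselected⁻ : ∀ {P i} → i ∈ˡ unselected G dec P → i ∉ P
  ∈unselected⁻ {P} i∈ = Product.proj₂ (∈-filter⁻ (λ j → ¬? (j ∈? P)) {xs = allFin N} i∈)

  nonGeneratingMove : ∀ {P} → ¬ Generates G P → 1 < #unselected P →
                      ∃ λ i → i ∉ P × ¬ Generates G (P ∪ ⁅ i ⁆)
  nonGeneratingMove {P} ¬gen 1<#P with ∣ I ─ P ∣ in eq
  ... | zero        = contradiction (from generates⇔∣I─P∣≡0 eq) ¬gen
  ... | suc (suc a) =
    let (i , i∈I , i∉P) = ∣p─q∣>0⇒∃ I P (subst (0 <_) (sym eq) z<s)
    in i , i∉P , ∣I─P∣≡1+n⇒¬generates (suc-injective (trans (sym (∣p─q∣≡1+∣p─[q∪⁅x⁆]∣ I P i∈I i∉P)) eq))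
  ... | suc zero    =
    let (i , i∈∁I , i∉P) = ∣p─q∣>0⇒∃ (∁ I) P (≤-pred 1<#P)
    in i , i∉P , ∣I─P∣≡1+n⇒¬generates (trans (cong ∣_∣ (x∉p⇒p─[q∪⁅x⁆]≡p─q I P (x∈∁p⇒x∉p i∈∁I))) eq)

  dngOptions : ℕ → Subset N → List ℕ
  dngOptions f P = map (λ i → nimDNGAt G dec f (P ∪ ⁅ i ⁆))
                       (filter (λ i → ¬? (dec (P ∪ ⁅ i ⁆))) (unselected G dec P))

  dngOption⁺ : ∀ {f P i} → i ∉ P → ¬ Generates G (P ∪ ⁅ i ⁆) →
               nimDNGAt G dec f (P ∪ ⁅ i ⁆) ∈ˡ dngOptions f P
  dngOption⁺ {f} {P} i∉P ¬gen =
    ∈-map⁺ (λ i → nimDNGAt G dec f (P ∪ ⁅ i ⁆)) (∈-filter⁺ (λ i → ¬? (dec (P ∪ ⁅ i ⁆))) (∈unselected⁺ i∉P) ¬gen)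

  dngOption⁻ : ∀ {f P y} → y ∈ˡ dngOptions f P →
               ∃ λ i → i ∉ P × ¬ Generates G (P ∪ ⁅ i ⁆) × y ≡ nimDNGAt G dec f (P ∪ ⁅ i ⁆)
  dngOption⁻ {f} {P} y∈ with ∈-map⁻ (λ i → nimDNGAt G dec f (P ∪ ⁅ i ⁆)) y∈
  ... | i , i∈ , y≡ =
    let (i∈unselected , ¬gen) = ∈-filter⁻ (λ i → ¬? (dec (P ∪ ⁅ i ⁆))) {xs = unselected G dec P} i∈
    in i , ∈unselected⁻ i∈unselected , ¬gen , y≡

  nimDNGAt≡ : ∀ f P → f ≡ #unselected P → ¬ Generates G P → nimDNGAt G dec f P ≡ suc f % 2
  nimDNGAt≡ zero    P f≡ ¬gen = contradiction (from generates⇔∣I─P∣≡0 (m+n≡0⇒m≡0 ∣ I ─ P ∣ (sym f≡))) ¬gen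
  nimDNGAt≡ (suc f) P f≡ ¬gen = mex≡n%2 f optionValue someOption
    where
    optionValue : ∀ {y} → y ∈ˡ dngOptions f P → y ≡ suc f % 2
    optionValue y∈ with dngOption⁻ {f} y∈
    ... | i , i∉P , ¬gen′ , refl =
      nimDNGAt≡ f (P ∪ ⁅ i ⁆) (suc-injective (trans f≡ (#unselected-select i∉P))) ¬gen′
    someOption : 0 < f → suc f % 2 ∈ˡ dngOptions f P
    someOption 0<f with nonGeneratingMove ¬gen (subst (1 <_) f≡ (s≤s 0<f))
    ... | i , i∉P , ¬gen′ = subst (_∈ˡ _) (optionValue (dngOption⁺ {f} i∉P ¬gen′)) (dngOption⁺ {f} i∉P ¬gen′)

  genOptions : ℕ → Subset N → List ℕ
  genOptions f P = map (λ i → nimGENAt G dec f (P ∪ ⁅ i ⁆)) (unselected G dec P)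

  genOption⁺ : ∀ {f P i} → i ∉ P → nimGENAt G dec f (P ∪ ⁅ i ⁆) ∈ˡ genOptions f P
  genOption⁺ {f} {P} i∉P = ∈-map⁺ (λ i → nimGENAt G dec f (P ∪ ⁅ i ⁆)) (∈unselected⁺ i∉P)

  genOption⁻ : ∀ {f P y} → y ∈ˡ genOptions f P → ∃ λ i → i ∉ P × y ≡ nimGENAt G dec f (P ∪ ⁅ i ⁆)
  genOption⁻ {f} {P} y∈ =
    Product.map₂ (Product.map₁ ∈unselected⁻) (∈-map⁻ (λ i → nimGENAt G dec f (P ∪ ⁅ i ⁆)) y∈)

  nimGENAt≡ : ∀ f P → f ≡ #unselected P → nimGENAt G dec f P ≡ genValue ∣ I ─ P ∣ f
  nimGENAt≡ zero P f≡ = cong (λ a → genValue a 0) (sym (m+n≡0⇒m≡0 ∣ I ─ P ∣ (sym f≡)))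
  nimGENAt≡ (suc f) P f≡ with dec P
  ... | yes gen = cong (λ a → genValue a (suc f)) (sym (to generates⇔∣I─P∣≡0 gen))
  ... | no ¬gen with ∣ I ─ P ∣ in eq
  ...   | zero  = contradiction (from generates⇔∣I─P∣≡0 eq) ¬gen
  ...   | suc a = mex-genValue a ∣ ∁ I ─ P ∣ (suc-injective f≡)
                    optionValue independentOption cliqueOption
    where
    option : ∀ {i} → i ∉ P → nimGENAt G dec f (P ∪ ⁅ i ⁆) ≡ genValue ∣ I ─ (P ∪ ⁅ i ⁆) ∣ f
    option {i} i∉P = nimGENAt≡ f (P ∪ ⁅ i ⁆)
      (suc-injective (trans f≡ (trans (cong (_+ ∣ ∁ I ─ P ∣) (sym eq)) (#unselected-select i∉P))))
    independentMove : ∀ {i} → i ∈ I → i ∉ P → nimGENAt G dec f (P ∪ ⁅ i ⁆) ≡ genValue a f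
    independentMove i∈I i∉P = trans (option i∉P)
      (cong (λ b → genValue b f) (suc-injective (trans (sym (∣p─q∣≡1+∣p─[q∪⁅x⁆]∣ I P i∈I i∉P)) eq)))
    cliqueMove : ∀ {i} → i ∉ I → i ∉ P → nimGENAt G dec f (P ∪ ⁅ i ⁆) ≡ genValue (suc a) f
    cliqueMove i∉I i∉P = trans (option i∉P)
      (cong (λ b → genValue b f) (trans (cong ∣_∣ (x∉p⇒p─[q∪⁅x⁆]≡p─q I P i∉I)) eq))
    optionValue : ∀ {y} → y ∈ˡ genOptions f P → y ≡ genValue a f ⊎ y ≡ genValue (suc a) f
    optionValue y∈ with genOption⁻ {f} y∈
    ... | i , i∉P , refl with i ∈? I
    ...   | yes i∈I = inj₁ (independentMove i∈I i∉P)
    ...   | no  i∉I = inj₂ (cliqueMove i∉I i∉P)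
    independentOption : genValue a f ∈ˡ genOptions f P
    independentOption = let (i , i∈I , i∉P) = ∣p─q∣>0⇒∃ I P (subst (0 <_) (sym eq) z<s)
                        in subst (_∈ˡ _) (independentMove i∈I i∉P) (genOption⁺ {f} i∉P)
    cliqueOption : 0 < ∣ ∁ I ─ P ∣ → genValue (suc a) f ∈ˡ genOptions f P
    cliqueOption 0<c = let (i , i∈∁I , i∉P) = ∣p─q∣>0⇒∃ (∁ I) P 0<c
                       in subst (_∈ˡ _) (cliqueMove (x∈∁p⇒x∉p i∈∁I) i∉P) (genOption⁺ {f} i∉P)

  nimDNG≡ : 0 < ∣ I ∣ → nimDNG G dec ≡ 1 ∸ N % 2
  nimDNG≡ 0<∣I∣ = trans (nimDNGAt≡ N ⊥ (sym #unselected-⊥) ¬generates⊥) ([1+n]%2≡1∸n%2 N)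
    where
    ¬generates⊥ : ¬ Generates G ⊥
    ¬generates⊥ gen = n>0⇒n≢0 0<∣I∣ (trans (sym (cong ∣_∣ (p─⊥≡p I))) (to generates⇔∣I─P∣≡0 gen))

  nimGEN≡ : 1 < ∣ I ∣ → nimGEN G dec ≡ N % 2
  nimGEN≡ 1<∣I∣ = trans (nimGENAt≡ N ⊥ (sym #unselected-⊥))
                        (genValue-≥2 N (subst (1 <_) (sym (cong ∣_∣ (p─⊥≡p I))) 1<∣I∣))

independents : (m n : ℕ) → Subset (m + n)
independents zero    n = ⊤
independents (suc m) n = outside ∷ independents m n

∣independents∣ : ∀ m n → ∣ independents m n ∣ ≡ n
∣independents∣ zero    n = ∣⊤∣≡n n
∣independents∣ (suc m) n = ∣independents∣ m n

∈independents⇒m≤ : ∀ m {n} {i : Fin (m + n)} → i ∈ independents m n → m ≤ toℕ i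
∈independents⇒m≤ zero    _                    = z≤n
∈independents⇒m≤ (suc m) {i = fsuc i} (there i∈) = s≤s (∈independents⇒m≤ m i∈)

∉independents⇒<m : ∀ m {n} {i : Fin (m + n)} → i ∉ independents m n → toℕ i < m
∉independents⇒<m zero                 i∉ = contradiction ∈⊤ i∉
∉independents⇒<m (suc m) {i = fzero}  _  = z<s
∉independents⇒<m (suc m) {i = fsuc i} i∉ = s<s (∉independents⇒<m m (i∉ ∘ there))

module CompleteSplit (m n : ℕ) where

  private
    G = completeSplit m n
    I = independents m n

  independent-nonadjacent : ∀ {x y} → x ∈ I → y ∈ I → ¬ G x y
  independent-nonadjacent x∈I _   (_ , inj₁ x<m) = <⇒≱ x<m (∈independents⇒m≤ m x∈I)
  independent-nonadjacent _   y∈I (_ , inj₂ y<m) = <⇒≱ y<m (∈independents⇒m≤ m y∈I)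

  edgeFromClique : ∀ {x y} → x ∉ I → x ≢ y → G x y
  edgeFromClique x∉I x≢y = x≢y , inj₁ (∉independents⇒<m m x∉I)

  edgeToClique : ∀ {x y} → y ∉ I → x ≢ y → G x y
  edgeToClique y∉I x≢y = x≢y , inj₂ (∉independents⇒<m m y∉I)

  viaClique : ∀ {x y v} → x ∈ I → y ∈ I → v ∉ I → Walk G x y
  viaClique x∈I y∈I v∉I =
    edgeToClique v∉I (λ { refl → v∉I x∈I }) ∷ edgeFromClique v∉I (λ { refl → v∉I y∈I }) ∷ []

  independents-distance≥2 : ∀ {x y} → x ∈ I → y ∈ I → x ≢ y → (w : Walk G x y) → 2 ≤ walkLength G w
  independents-distance≥2 _   _   x≢y []          = contradiction refl x≢y
  independents-distance≥2 x∈I y∈I _   (e ∷ [])    = contradiction e (independent-nonadjacent x∈I y∈I)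
  independents-distance≥2 _   _   _   (_ ∷ _ ∷ _) = s≤s (s≤s z≤n)

  clique⊆convex : ∀ {S x y v} → Convex G S → x ∈ S → y ∈ S → x ∈ I → y ∈ I → x ≢ y → v ∉ I → v ∈ S
  clique⊆convex convex x∈S y∈S x∈I y∈I x≢y v∉I =
    convex _ _ x∈S y∈S (viaClique x∈I y∈I v∉I) (independents-distance≥2 x∈I y∈I x≢y) _ (there here)

  shortest-twoSteps : ∀ {x v u y} (e : G x v) (e′ : G v u) (w : Walk G u y) →
                      IsShortest G (e ∷ e′ ∷ w) → x ∈ I × y ∈ I × x ≢ y × v ∉ I
  shortest-twoSteps {x} {y = y} e _ _ shortest with x ≟ y
  ... | yes refl = contradiction (shortest []) λ ()
  ... | no x≢y with x ∈? I | y ∈? I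
  ...   | no x∉I  | _       = contradiction (shortest (edgeFromClique x∉I x≢y ∷ [])) λ { (s≤s ()) }
  ...   | yes _   | no y∉I  = contradiction (shortest (edgeToClique y∉I x≢y ∷ [])) λ { (s≤s ()) }
  ...   | yes x∈I | yes y∈I = x∈I , y∈I , x≢y , λ v∈I → independent-nonadjacent x∈I v∈I e

  shortest-onWalk : ∀ {x y z} (w : Walk G x y) → IsShortest G w → OnWalk G z w →
                    z ≡ x ⊎ z ≡ y ⊎ (x ∈ I × y ∈ I × x ≢ y × z ∉ I)
  shortest-onWalk []            _        here                 = inj₁ refl
  shortest-onWalk (_ ∷ [])      _        here                 = inj₁ refl
  shortest-onWalk (_ ∷ [])      _        (there here)         = inj₂ (inj₁ refl)
  shortest-onWalk (_ ∷ _ ∷ _)   _        here                 = inj₁ refl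
  shortest-onWalk (e ∷ e′ ∷ []) shortest (there here)         = inj₂ (inj₂ (shortest-twoSteps e e′ [] shortest))
  shortest-onWalk (_ ∷ _ ∷ [])  _        (there (there here)) = inj₂ (inj₁ refl)
  shortest-onWalk (e ∷ e′ ∷ e″ ∷ w) shortest (there _) =
    let (x∈I , y∈I , _ , v∉I) = shortest-twoSteps e e′ (e″ ∷ w) shortest
    in contradiction (shortest (viaClique x∈I y∈I v∉I)) λ { (s≤s (s≤s ())) }

  HasTwoIndependents : Subset (m + n) → Set
  HasTwoIndependents P = ∃₂ λ a b → a ∈ I × b ∈ I × a ≢ b × a ∈ P × b ∈ P

  hasTwoIndependents? : ∀ P → Dec (HasTwoIndependents P)
  hasTwoIndependents? P = any? λ a → any? λ b →
    (a ∈? I) ×-dec (b ∈? I) ×-dec ¬? (a ≟ b) ×-dec (a ∈? P) ×-dec (b ∈? P)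

  isHull-∪clique : ∀ {P} → HasTwoIndependents P → IsHull G (P ∪ ∁ I) P
  isHull-∪clique {P} (a , b , a∈I , b∈I , a≢b , a∈P , b∈P) = convex , p⊆p∪q (∁ I) , least
    where
    convex : Convex G (P ∪ ∁ I)
    convex x y x∈ y∈ w shortest z z∈w with shortest-onWalk w shortest z∈w
    ... | inj₁ refl                    = x∈
    ... | inj₂ (inj₁ refl)             = y∈
    ... | inj₂ (inj₂ (_ , _ , _ , z∉I)) = q⊆p∪q P (∁ I) (x∉p⇒x∈∁p z∉I)
    least : ∀ S → Convex G S → P ⊆ S → P ∪ ∁ I ⊆ S
    least S convexS P⊆S v∈ with x∈p∪q⁻ P (∁ I) v∈
    ... | inj₁ v∈P  = P⊆S v∈P
    ... | inj₂ v∈∁I = clique⊆convex convexS (P⊆S a∈P) (P⊆S b∈P) a∈I b∈I a≢b (x∈∁p⇒x∉p v∈∁I)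

  isHull-self : ∀ {P} → ¬ HasTwoIndependents P → IsHull G P P
  isHull-self {P} ¬two = convex , (λ x∈P → x∈P) , λ _ _ P⊆S → P⊆S
    where
    convex : Convex G P
    convex x y x∈P y∈P w shortest z z∈w with shortest-onWalk w shortest z∈w
    ... | inj₁ refl                          = x∈P
    ... | inj₂ (inj₁ refl)                   = y∈P
    ... | inj₂ (inj₂ (x∈I , y∈I , x≢y , _)) = contradiction (x , y , x∈I , y∈I , x≢y , x∈P , y∈P) ¬two

  missingIndependent⇒¬generates : ∀ {P j} → j ∈ I → j ∉ P → ¬ Generates G P
  missingIndependent⇒¬generates {P} {j} j∈I j∉P gen with hasTwoIndependents? P
  ... | yes two = [ j∉P , (λ j∈∁I → x∈∁p⇒x∉p j∈∁I j∈I) ] (x∈p∪q⁻ P (∁ I) (gen _ (isHull-∪clique two) j))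
  ... | no ¬two = j∉P (gen P (isHull-self ¬two) j)

  independents⊆⇒generates : 1 < n → ∀ {P} → I ⊆ P → Generates G P
  independents⊆⇒generates 1<n I⊆P H (convexH , P⊆H , _) v with v ∈? I
  ... | yes v∈I = P⊆H (I⊆P v∈I)
  ... | no  v∉I =
    let (a , b , a∈I , b∈I , a≢b) = ∣p∣>1⇒∃≢ I (subst (1 <_) (sym (∣independents∣ m n)) 1<n)
    in clique⊆convex convexH (P⊆H (I⊆P a∈I)) (P⊆H (I⊆P b∈I)) a∈I b∈I a≢b v∉I

  generates⇔independents⊆ : 1 < n → ∀ {P} → Generates G P ⇔ I ⊆ P
  generates⇔independents⊆ 1<n {P} = mk⇔
    (λ gen {j} j∈I → decidable-stable (j ∈? P) λ j∉P → missingIndependent⇒¬generates j∈I j∉P gen)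
    (independents⊆⇒generates 1<n)

proposition6p9 : (m n : ℕ) → 2 ≤ n →
    (dec : (P : Subset (m + n)) → Dec (Generates (completeSplit m n) P)) →
    (nimDNG (completeSplit m n) dec ≡ 1 ∸ ((m + n) % 2))
    × (nimGEN (completeSplit m n) dec ≡ (m + n) % 2)
proposition6p9 m n 2≤n dec = nimDNG≡ (<⇒≤ 1<∣I∣) , nimGEN≡ 1<∣I∣
  where
  open SupersetGeneration (completeSplit m n) (independents m n)
                          (CompleteSplit.generates⇔independents⊆ m n 2≤n) dec
  1<∣I∣ : 1 < ∣ independents m n ∣
  1<∣I∣ = subst (1 <_) (sym (∣independents∣ m n)) 2≤n
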